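{- Let $\mathbb{K}$ be an infinite commutative field and let $n\ge3$ be an odd integer. There exists an irreducible $\lambda$-quiddity of size $n$ over $\mathbb{K}$. In particular, $\ell_{\mathbb{K}}=+\infty$.
   Context: For a commutative unitary ring $B$ and $a_1,\dots,a_n\in B$, set $M_n(a_1,\dots,a_n)=\begin{pmatrix}a_n&-1\\1&0\end{pmatrix}\cdots\begin{pmatrix}a_1&-1\\1&0\end{pmatrix}$. An $n$-tuple $(a_1,\dots,a_n)\in B^n$ is a $\lambda$-quiddity (of size $n$) over $B$ if $M_n(a_1,\dots,a_n)=\epsilon\,\mathrm{Id}$ for some $\epsilon\in\{\pm1_B\}$. For $(a_1,\dots,a_n)\in B^n$, $(b_1,\dots,b_m)\in B^m$ define $(a_1,\dots,a_n)\oplus(b_1,\dots,b_m)=(a_1+b_m,a_2,\dots,a_{n-1},a_n+b_1,b_2,\dots,b_{m-1})$. Two $n$-tuples are equivalent ($\sim$) if one is obtained from the other or from its reversal by a cyclic rotation. A $\lambda$-quiddity $(c_1,\dots,c_n)$ with $n\ge3$ is reducible if there exist a $\lambda$-quiddity $(b_1,\dots,b_l)$ and $(a_1,\dots,a_m)\in B^m$ with $m,l\ge3$ and $(c_1,\dots,c_n)\sim(a_1,\dots,a_m)\oplus(b_1,\dots,b_l)$; otherwise it is irreducible ($(0,0)$ is never irreducible). $\ell_B$ is the maximal size of irreducible $\lambda$-quiddities over $B$ if bounded, and $+\infty$ otherwise. -}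

module Defs where

open import Level using (Level; _⊔_)
open import Algebra.Bundles using (CommutativeRing)
open import Data.Nat using (ℕ; zero; suc; _≤_; _<_)
open import Data.List using (List; []; _∷_; _++_; [_]; length; reverse; take; drop)
open import Data.List.Relation.Binary.Pointwise using (Pointwise)
open import Data.List.Membership.Setoid using (_∉_)
open import Data.Product using (Σ; ∃; _×_; _,_)
open import Data.Sum using (_⊎_)
open import Relation.Nullary using (¬_)

record IsField {c ℓ} (R : CommutativeRing c ℓ) : Set (c ⊔ ℓ) where
  open CommutativeRing R
  field
    1≉0     : ¬ (1# ≈ 0#)
    inverse : ∀ x → ¬ (x ≈ 0#) → Σ Carrier (λ y → x * y ≈ 1#)

Infinite : ∀ {c ℓ} (R : CommutativeRing c ℓ) → Set (c ⊔ ℓ)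
Infinite R = ∀ (xs : List Carrier) → Σ Carrier (λ x → _∉_ setoid x xs)
  where open CommutativeRing R

module Quiddity {c ℓ} (B : CommutativeRing c ℓ) where
  open CommutativeRing B

  record Mat : Set c where
    constructor mat
    field
      m11 m12 m21 m22 : Carrier

  _·_ : Mat → Mat → Mat
  mat a b c' d · mat e f g h =
    mat (a * e + b * g) (a * f + b * h) (c' * e + d * g) (c' * f + d * h)

  Id : Mat
  Id = mat 1# 0# 0# 1#

  E : Carrier → Mat
  E a = mat a (- 1#) 1# 0#

  M : List Carrier → Mat
  M []       = Id
  M (a ∷ as) = M as · E a

  scal : Carrier → Mat → Mat
  scal e (mat a b c' d) = mat (e * a) (e * b) (e * c') (e * d)

  _≈M_ : Mat → Mat → Set ℓ
  mat a b c' d ≈M mat a' b' c'' d' = (a ≈ a') × (b ≈ b') × (c' ≈ c'') × (d ≈ d')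

  IsQuiddity : List Carrier → Set ℓ
  IsQuiddity as = (M as ≈M scal 1# Id) ⊎ (M as ≈M scal (- 1#) Id)

  lastOf : Carrier → List Carrier → Carrier
  lastOf x []       = x
  lastOf x (y ∷ ys) = lastOf y ys

  initOf : Carrier → List Carrier → List Carrier
  initOf x []       = []
  initOf x (y ∷ ys) = x ∷ initOf y ys

  -- (a₁,…,aₘ) ⊕ (b₁,…,b_l) = (a₁+b_l, a₂,…,a_{m-1}, aₘ+b₁, b₂,…,b_{l-1})
  -- (only meaningful for m, l ≥ 2; used only for m, l ≥ 3)
  _⊕_ : List Carrier → List Carrier → List Carrier
  (a₁ ∷ a₂ ∷ as) ⊕ (b₁ ∷ b₂ ∷ bs) =
    (a₁ + lastOf b₂ bs) ∷ initOf a₂ as ++ [ lastOf a₂ as + b₁ ] ++ initOf b₂ bs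
  _ ⊕ _ = []

  _≋_ : List Carrier → List Carrier → Set (c ⊔ ℓ)
  _≋_ = Pointwise _≈_

  rotate : ℕ → List Carrier → List Carrier
  rotate k xs = drop k xs ++ take k xs

  _∼_ : List Carrier → List Carrier → Set (c ⊔ ℓ)
  xs ∼ ys = Σ ℕ (λ k → k < length xs × ((ys ≋ rotate k xs) ⊎ (ys ≋ rotate k (reverse xs))))

  Reducible : List Carrier → Set (c ⊔ ℓ)
  Reducible cs = Σ (List Carrier) λ as → Σ (List Carrier) λ bs →
    IsQuiddity bs × 3 ≤ length as × 3 ≤ length bs × (cs ∼ (as ⊕ bs))

  -- irreducible λ-quiddity (size ≥ 3; (0,0) is never irreducible)
  Irreducible : List Carrier → Set (c ⊔ ℓ)
  Irreducible cs = IsQuiddity cs × 3 ≤ length cs × ¬ Reducible cs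

-- Read a tuple c₁ … cₙ through the solution V 0, V 1, … of the discrete Hill equation
-- V (i+2) = c_{i+1} V (i+1) − V i started at V 0 = (0,1), V 1 = (1,0); the continuant (top-left
-- entry of M) of a block c_{i+1} … c_{j−1} is then ± det (V i) (V j).  If c ∼ a ⊕ b with b a
-- λ-quiddity, then the inside of b is a block of at most n − 3 cyclically consecutive entries of c
-- whose continuant is ±1, i.e. two non-adjacent vertices of the closed polygon V 0, …, V (n−1) with
-- determinant ±1.  Over an infinite field the entries can be chosen one at a time so that every
-- new determinant avoids finitely many values, each condition being affine in the new entry with
-- nonzero slope; three more entries, forced by V n = V 0 and V (n+1) = V 1, close the polygon, and
-- an extra generic condition maintained along the way keeps the determinants created by closing
-- away from ±1.  This gives irreducible λ-quiddities of every size n ≥ 3.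

module Submission where

open import Algebra.Bundles using (CommutativeRing)
import Algebra.Solver.Ring
open import Algebra.Solver.Ring.AlmostCommutativeRing using (fromCommutativeRing; _-Raw-AlmostCommutative⟶_)
open import Data.Empty using (⊥-elim)
open import Data.Integer as ℤ using (ℤ; +_; -[1+_])
import Data.Integer.Properties as ℤ
open import Data.List using (List; []; _∷_; _++_; _∷ʳ_; [_]; length; reverse; foldl; take; drop; map)
import Data.List.Properties as List
open import Data.List.Relation.Binary.Pointwise using (Pointwise; []; _∷_; Pointwise-length)
open import Data.List.Relation.Unary.Any as Any using (here; there)
import Data.List.Relation.Unary.Any.Properties as Anyₚ
open import Data.Maybe using (Maybe; just; nothing)
open import Data.Nat as ℕ using (ℕ; zero; suc; _≤_; _<_; z≤n; s≤s; z<s; s<s)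
import Data.Nat.Properties as ℕ
open import Data.Product using (Σ; ∃; ∃₂; _×_; _,_; proj₁; proj₂)
open import Data.Product.Relation.Binary.Pointwise.NonDependent using (_×ₛ_)
open import Data.Sign as Sign using (Sign)
open import Data.Sum using (_⊎_; inj₁; inj₂; [_,_]′)
open import Function using (flip; _∘_)
open import Level using (_⊔_)
open import Relation.Binary using (Setoid)
open import Relation.Binary.PropositionalEquality as ≡ using (_≡_)
import Relation.Binary.Reasoning.Setoid as SetoidReasoning
open import Relation.Nullary using (¬_; yes; no)

open import Defs

-- Algebra.Solver.Ring normalises over a coefficient ring with decidable equality, and ℤ maps into
-- every commutative ring.
module CommutativeRingSolver {c ℓ} (K : CommutativeRing c ℓ) where
  open CommutativeRing K
  open import Algebra.Properties.Ring ring using (-1*x≈-x; -‿involutive; -‿+-comm; -0#≈0#)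
  open import Algebra.Properties.Semiring.Mult.TCOptimised semiring
    using (×-homo-+; ×1-homo-*) renaming (_×_ to _×′_)
  open import Algebra.Properties.CommutativeSemigroup +-commutativeSemigroup using (interchange)
  open import Algebra.Properties.CommutativeSemigroup *-commutativeSemigroup
    using () renaming (interchange to *-interchange)
  open SetoidReasoning setoid

  ⟦_⟧ℤ : ℤ → Carrier
  ⟦ + n ⟧ℤ      = n ×′ 1#
  ⟦ -[1+ n ] ⟧ℤ = - (suc n ×′ 1#)

  ⟦_⟧ₛ : Sign → Carrier
  ⟦ Sign.+ ⟧ₛ = 1#
  ⟦ Sign.- ⟧ₛ = - 1#

  ⊖-homo : ∀ m n → ⟦ m ℤ.⊖ n ⟧ℤ ≈ m ×′ 1# - n ×′ 1#
  ⊖-homo zero    zero    = sym (-‿inverseʳ 0#)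
  ⊖-homo zero    (suc n) = sym (+-identityˡ _)
  ⊖-homo (suc m) zero    = sym (trans (+-congˡ -0#≈0#) (+-identityʳ _))
  ⊖-homo (suc m) (suc n) = begin
    ⟦ suc m ℤ.⊖ suc n ⟧ℤ                ≡⟨ ≡.cong ⟦_⟧ℤ (ℤ.[1+m]⊖[1+n]≡m⊖n m n) ⟩
    ⟦ m ℤ.⊖ n ⟧ℤ                        ≈⟨ ⊖-homo m n ⟩
    m ×′ 1# - n ×′ 1#                   ≈⟨ +-identityˡ _ ⟨
    0# + (m ×′ 1# - n ×′ 1#)            ≈⟨ +-congʳ (-‿inverseʳ 1#) ⟨
    (1# - 1#) + (m ×′ 1# - n ×′ 1#)     ≈⟨ interchange 1# (- 1#) (m ×′ 1#) (- (n ×′ 1#)) ⟩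
    (1# + m ×′ 1#) + (- 1# - n ×′ 1#)   ≈⟨ +-congˡ (-‿+-comm 1# (n ×′ 1#)) ⟩
    (1# + m ×′ 1#) - (1# + n ×′ 1#)     ≈⟨ +-cong (×-homo-+ 1# 1 m) (-‿cong (×-homo-+ 1# 1 n)) ⟨
    suc m ×′ 1# - suc n ×′ 1#           ∎

  +-homo : ∀ i j → ⟦ i ℤ.+ j ⟧ℤ ≈ ⟦ i ⟧ℤ + ⟦ j ⟧ℤ
  +-homo (+ m)    (+ n)    = ×-homo-+ 1# m n
  +-homo (+ m)    -[1+ n ] = ⊖-homo m (suc n)
  +-homo -[1+ m ] (+ n)    = trans (⊖-homo n (suc m)) (+-comm _ _)
  +-homo -[1+ m ] -[1+ n ] = begin
    - (suc (suc (m ℕ.+ n)) ×′ 1#)       ≡⟨ ≡.cong (λ k → - (suc k ×′ 1#)) (ℕ.+-suc m n) ⟨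
    - ((suc m ℕ.+ suc n) ×′ 1#)         ≈⟨ -‿cong (×-homo-+ 1# (suc m) (suc n)) ⟩
    - (suc m ×′ 1# + suc n ×′ 1#)       ≈⟨ -‿+-comm _ _ ⟨
    - (suc m ×′ 1#) - suc n ×′ 1#       ∎

  -‿homo : ∀ i → ⟦ ℤ.- i ⟧ℤ ≈ - ⟦ i ⟧ℤ
  -‿homo (+ zero)  = sym -0#≈0#
  -‿homo (+ suc n) = refl
  -‿homo -[1+ n ]  = sym (-‿involutive _)

  ◃-homo : ∀ s n → ⟦ s ℤ.◃ n ⟧ℤ ≈ ⟦ s ⟧ₛ * (n ×′ 1#)
  ◃-homo s      zero    = sym (zeroʳ _)
  ◃-homo Sign.+ (suc n) = sym (*-identityˡ _)
  ◃-homo Sign.- (suc n) = sym (-1*x≈-x _)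

  sign-homo : ∀ s t → ⟦ s Sign.* t ⟧ₛ ≈ ⟦ s ⟧ₛ * ⟦ t ⟧ₛ
  sign-homo Sign.+ t      = sym (*-identityˡ _)
  sign-homo Sign.- Sign.+ = sym (*-identityʳ _)
  sign-homo Sign.- Sign.- = sym (trans (-1*x≈-x _) (-‿involutive _))

  *-homo : ∀ i j → ⟦ i ℤ.* j ⟧ℤ ≈ ⟦ i ⟧ℤ * ⟦ j ⟧ℤ
  *-homo i j = begin
    ⟦ s Sign.* t ℤ.◃ m ℕ.* n ⟧ℤ                 ≈⟨ ◃-homo (s Sign.* t) (m ℕ.* n) ⟩
    ⟦ s Sign.* t ⟧ₛ * ((m ℕ.* n) ×′ 1#)         ≈⟨ *-cong (sign-homo s t) (×1-homo-* m n) ⟩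
    (⟦ s ⟧ₛ * ⟦ t ⟧ₛ) * (m ×′ 1# * (n ×′ 1#))   ≈⟨ *-interchange _ _ _ _ ⟩
    ⟦ s ⟧ₛ * (m ×′ 1#) * (⟦ t ⟧ₛ * (n ×′ 1#))   ≈⟨ *-cong (◃-homo s m) (◃-homo t n) ⟨
    ⟦ s ℤ.◃ m ⟧ℤ * ⟦ t ℤ.◃ n ⟧ℤ                 ≡⟨ ≡.cong₂ (λ i j → ⟦ i ⟧ℤ * ⟦ j ⟧ℤ)
                                                        (ℤ.◃-inverse i) (ℤ.◃-inverse j) ⟩
    ⟦ i ⟧ℤ * ⟦ j ⟧ℤ                             ∎
    where s = ℤ.sign i; t = ℤ.sign j; m = ℤ.∣ i ∣; n = ℤ.∣ j ∣

  morphism : ℤ.+-*-rawRing -Raw-AlmostCommutative⟶ fromCommutativeRing K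
  morphism = record
    { ⟦_⟧    = ⟦_⟧ℤ
    ; +-homo = +-homo
    ; *-homo = *-homo
    ; -‿homo = -‿homo
    ; 0-homo = refl
    ; 1-homo = refl
    }

  ℤ-equal? : ∀ i j → Maybe (⟦ i ⟧ℤ ≈ ⟦ j ⟧ℤ)
  ℤ-equal? i j with i ℤ.≟ j
  ... | yes ≡.refl = just refl
  ... | no _       = nothing

  open Algebra.Solver.Ring ℤ.+-*-rawRing (fromCommutativeRing K) morphism ℤ-equal? public
    using (solve; _:=_; _:+_; _:*_; _:-_; :-_; con)

∀<suc : ∀ {p} {P : ℕ → Set p} {n} → P n → (∀ {i} → i < n → P i) → ∀ {i} → i < suc n → P i
∀<suc Pn P< i<1+n with ℕ.m≤n⇒m<n∨m≡n (ℕ.≤-pred i<1+n)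
... | inj₁ i<n    = P< i<n
... | inj₂ ≡.refl = Pn

m≤n⇒∃[o]n≡o+m : ∀ {m n} → m ≤ n → ∃ λ o → n ≡ o ℕ.+ m
m≤n⇒∃[o]n≡o+m m≤n = _ , ≡.sym (ℕ.m∸n+n≡m m≤n)

Pointwise-++-split : ∀ {a b r} {A : Set a} {B : Set b} {R : A → B → Set r} xs {ys zs} →
                     Pointwise R (xs ++ ys) zs →
                     ∃₂ λ xs′ ys′ → zs ≡ xs′ ++ ys′ × Pointwise R xs xs′ × Pointwise R ys ys′
Pointwise-++-split []       rs       = [] , _ , ≡.refl , [] , rs
Pointwise-++-split (x ∷ xs) (r ∷ rs) =
  let xs′ , ys′ , eq , rs₁ , rs₂ = Pointwise-++-split xs rs in _ ∷ xs′ , ys′ , ≡.cong (_ ∷_) eq , r ∷ rs₁ , rs₂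

module _ {a} {A : Set a} where
  open ≡.≡-Reasoning

  length-∷ʳ : ∀ (xs : List A) x → length (xs ∷ʳ x) ≡ suc (length xs)
  length-∷ʳ xs x = ≡.trans (List.length-++ xs) (ℕ.+-comm (length xs) 1)

  length-rotate : ∀ k (xs : List A) → length (drop k xs ++ take k xs) ≡ length xs
  length-rotate k xs =
    ≡.trans (List.length-++-comm (drop k xs) (take k xs)) (≡.cong length (List.take++drop≡id k xs))

  rotate-infix : ∀ k (xs : List A) {X Y} → drop k xs ++ take k xs ≡ X ++ Y →
                 xs ++ xs ≡ (take k xs ++ X) ++ Y ++ drop k xs
  rotate-infix k xs {X} {Y} eq = begin
    xs ++ xs               ≡⟨ ≡.cong₂ _++_ (List.take++drop≡id k xs) (List.take++drop≡id k xs) ⟨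
    (T ++ D) ++ (T ++ D)   ≡⟨ List.++-assoc T D (T ++ D) ⟩
    T ++ (D ++ (T ++ D))   ≡⟨ ≡.cong (T ++_) (List.++-assoc D T D) ⟨
    T ++ ((D ++ T) ++ D)   ≡⟨ ≡.cong (λ R → T ++ (R ++ D)) eq ⟩
    T ++ ((X ++ Y) ++ D)   ≡⟨ ≡.cong (T ++_) (List.++-assoc X Y D) ⟩
    T ++ (X ++ (Y ++ D))   ≡⟨ List.++-assoc T X (Y ++ D) ⟨
    (T ++ X) ++ Y ++ D     ∎
    where T = take k xs; D = drop k xs

module Continuants {c ℓ} (K : CommutativeRing c ℓ) where
  open CommutativeRing K
  open Quiddity K
  open CommutativeRingSolver K using (solve; _:=_; _:+_; _:*_; _:-_; :-_; con)
  open import Algebra.Properties.Ring ring using (-‿involutive; -‿injective; -1*x≈-x; -0#≈0#)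

  K² : Set c
  K² = Carrier × Carrier

  K²-setoid : Setoid c ℓ
  K²-setoid = setoid ×ₛ setoid

  open Setoid K²-setoid public
    using () renaming (_≈_ to _≈²_; refl to ≈²-refl; reflexive to ≈²-reflexive; trans to ≈²-trans)

  e₀ e₁ : K²
  e₀ = 0# , 1#
  e₁ = 1# , 0#

  infixl 7 _⊙_
  infixl 6 _⊖_

  _⊙_ : Carrier → K² → K²
  a ⊙ (x₁ , x₂) = a * x₁ , a * x₂

  _⊖_ : K² → K² → K²
  (x₁ , x₂) ⊖ (y₁ , y₂) = x₁ - y₁ , x₂ - y₂

  det : K² → K² → Carrier
  det (x₁ , x₂) (y₁ , y₂) = x₁ * y₂ - x₂ * y₁

  det-cong : ∀ {x x′ y y′} → x ≈² x′ → y ≈² y′ → det x y ≈ det x′ y′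
  det-cong (x₁ , x₂) (y₁ , y₂) = +-cong (*-cong x₁ y₂) (-‿cong (*-cong x₂ y₁))

  det-antisym : ∀ x y → det x y ≈ - det y x
  det-antisym (x₁ , x₂) (y₁ , y₂) =
    solve 4 (λ x₁ x₂ y₁ y₂ → x₁ :* y₂ :- x₂ :* y₁ := :- (y₁ :* x₂ :- y₂ :* x₁)) refl x₁ x₂ y₁ y₂

  det-linearʳ : ∀ t a y x → det t (a ⊙ y ⊖ x) ≈ a * det t y - det t x
  det-linearʳ (t₁ , t₂) a (y₁ , y₂) (x₁ , x₂) =
    solve 7 (λ t₁ t₂ a y₁ y₂ x₁ x₂ → t₁ :* (a :* y₂ :- x₂) :- t₂ :* (a :* y₁ :- x₁)
                                     := a :* (t₁ :* y₂ :- t₂ :* y₁) :- (t₁ :* x₂ :- t₂ :* x₁))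
      refl t₁ t₂ a y₁ y₂ x₁ x₂

  det-step : ∀ a y x → det (a ⊙ y ⊖ x) y ≈ det y x
  det-step a (y₁ , y₂) (x₁ , x₂) =
    solve 5 (λ a y₁ y₂ x₁ x₂ → (a :* y₁ :- x₁) :* y₂ :- (a :* y₂ :- x₂) :* y₁ := y₁ :* x₂ :- y₂ :* x₁)
      refl a y₁ y₂ x₁ x₂

  Mat-setoid : Setoid c ℓ
  Mat-setoid = record
    { Carrier       = Mat
    ; _≈_           = _≈M_
    ; isEquivalence = record
      { refl  = refl , refl , refl , refl
      ; sym   = λ (a , b , c , d) → sym a , sym b , sym c , sym d
      ; trans = λ (a , b , c , d) (a′ , b′ , c′ , d′) → trans a a′ , trans b b′ , trans c c′ , trans d d′
      }
    }

  module ≈M-Reasoning = SetoidReasoning Mat-setoid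
  open Setoid Mat-setoid public using () renaming (refl to ≈M-refl; sym to ≈M-sym; trans to ≈M-trans)

  ·-cong : ∀ {A A′ B B′} → A ≈M A′ → B ≈M B′ → (A · B) ≈M (A′ · B′)
  ·-cong (a , b , c , d) (e , f , g , h) =
    +-cong (*-cong a e) (*-cong b g) , +-cong (*-cong a f) (*-cong b h) ,
    +-cong (*-cong c e) (*-cong d g) , +-cong (*-cong c f) (*-cong d h)

  ·-assoc : ∀ A B C → ((A · B) · C) ≈M (A · (B · C))
  ·-assoc (mat a b c d) (mat e f g h) (mat i j k l) =
    entry a b e f g h i k , entry a b e f g h j l , entry c d e f g h i k , entry c d e f g h j l
    where
    entry : ∀ x y e f g h z w →
            (x * e + y * g) * z + (x * f + y * h) * w ≈ x * (e * z + f * w) + y * (g * z + h * w)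
    entry = solve 8 (λ x y e f g h z w → (x :* e :+ y :* g) :* z :+ (x :* f :+ y :* h) :* w
                                         := x :* (e :* z :+ f :* w) :+ y :* (g :* z :+ h :* w)) refl

  private
    1x+0y≈x : ∀ x y → 1# * x + 0# * y ≈ x
    1x+0y≈x x y = trans (+-cong (*-identityˡ x) (zeroˡ y)) (+-identityʳ x)

    0x+1y≈y : ∀ x y → 0# * x + 1# * y ≈ y
    0x+1y≈y x y = trans (+-cong (zeroˡ x) (*-identityˡ y)) (+-identityˡ y)

    x1+y0≈x : ∀ x y → x * 1# + y * 0# ≈ x
    x1+y0≈x x y = trans (+-cong (*-identityʳ x) (zeroʳ y)) (+-identityʳ x)

    x0+y1≈y : ∀ x y → x * 0# + y * 1# ≈ y
    x0+y1≈y x y = trans (+-cong (zeroʳ x) (*-identityʳ y)) (+-identityˡ y)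

  ·-identityˡ : ∀ A → (Id · A) ≈M A
  ·-identityˡ (mat a b c d) = 1x+0y≈x a c , 1x+0y≈x b d , 0x+1y≈y a c , 0x+1y≈y b d

  ·-identityʳ : ∀ A → (A · Id) ≈M A
  ·-identityʳ (mat a b c d) = x1+y0≈x a b , x0+y1≈y a b , x1+y0≈x c d , x0+y1≈y c d

  M-∷ʳ : ∀ xs a → M (xs ∷ʳ a) ≈M (E a · M xs)
  M-∷ʳ []       a = ≈M-trans (·-identityˡ (E a)) (≈M-sym (·-identityʳ (E a)))
  M-∷ʳ (x ∷ xs) a = begin
    M (xs ∷ʳ a) · E x    ≈⟨ ·-cong (M-∷ʳ xs a) ≈M-refl ⟩
    (E a · M xs) · E x   ≈⟨ ·-assoc (E a) (M xs) (E x) ⟩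
    E a · (M xs · E x)   ∎
    where open ≈M-Reasoning

  M-cong : ∀ {xs ys} → Pointwise _≈_ xs ys → M xs ≈M M ys
  M-cong []       = ≈M-refl
  M-cong (p ∷ ps) = ·-cong (M-cong ps) (p , refl , refl , refl)

  -- J Aᵀ J with J = diag(1, −1): an anti-automorphism fixing every E a, so it turns M xs into M (reverse xs).
  Jᵀ : Mat → Mat
  Jᵀ (mat a b c d) = mat a (- c) (- b) d

  Jᵀ-anti : ∀ A B → Jᵀ (A · B) ≈M (Jᵀ B · Jᵀ A)
  Jᵀ-anti (mat a b c d) (mat e f g h) =
    solve 4 (λ a b e g → a :* e :+ b :* g := e :* a :+ (:- g) :* (:- b)) refl a b e g ,
    solve 4 (λ c d e g → :- (c :* e :+ d :* g) := e :* (:- c) :+ (:- g) :* d) refl c d e g ,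
    solve 4 (λ a b f h → :- (a :* f :+ b :* h) := (:- f) :* a :+ h :* (:- b)) refl a b f h ,
    solve 4 (λ c d f h → c :* f :+ d :* h := (:- f) :* (:- c) :+ h :* d) refl c d f h

  M-reverse : ∀ xs → M (reverse xs) ≈M Jᵀ (M xs)
  M-reverse []       = refl , sym -0#≈0# , sym -0#≈0# , refl
  M-reverse (x ∷ xs) = begin
    M (reverse (x ∷ xs))   ≡⟨ ≡.cong M (List.unfold-reverse x xs) ⟩
    M (reverse xs ∷ʳ x)    ≈⟨ M-∷ʳ (reverse xs) x ⟩
    E x · M (reverse xs)   ≈⟨ ·-cong (refl , refl , sym (-‿involutive 1#) , refl) (M-reverse xs) ⟩
    Jᵀ (E x) · Jᵀ (M xs)   ≈⟨ Jᵀ-anti (M xs) (E x) ⟨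
    Jᵀ (M xs · E x)        ∎
    where open ≈M-Reasoning

  m11-reverse : ∀ xs → Mat.m11 (M (reverse xs)) ≈ Mat.m11 (M xs)
  m11-reverse xs = proj₁ (M-reverse xs)

  m22-E·A·E : ∀ b′ A b → Mat.m22 ((E b′ · A) · E b) ≈ - Mat.m11 A
  m22-E·A·E b′ (mat a₁₁ a₁₂ a₂₁ a₂₂) b =
    solve 4 (λ a₁₁ a₁₂ a₂₁ a₂₂ →
      (con (+ 1) :* a₁₁ :+ con (+ 0) :* a₂₁) :* (:- con (+ 1)) :+ (con (+ 1) :* a₁₂ :+ con (+ 0) :* a₂₂) :* con (+ 0)
        := :- a₁₁) refl a₁₁ a₁₂ a₂₁ a₂₂

  m22-M-∷-∷ʳ : ∀ b B b′ → Mat.m22 (M (b ∷ (B ∷ʳ b′))) ≈ - Mat.m11 (M B)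
  m22-M-∷-∷ʳ b B b′ =
    trans (proj₂ (proj₂ (proj₂ (·-cong (M-∷ʳ B b′) (≈M-refl {E b}))))) (m22-E·A·E b′ (M B) b)

  quiddity-inner : ∀ b B b′ → IsQuiddity (b ∷ (B ∷ʳ b′)) → Mat.m11 (M B) ≈ 1# ⊎ Mat.m11 (M B) ≈ - 1#
  quiddity-inner b B b′ (inj₁ (_ , _ , _ , m22≈1)) = inj₂ (-‿injective
    (trans (sym (m22-M-∷-∷ʳ b B b′)) (trans m22≈1 (trans (*-identityʳ 1#) (sym (-‿involutive 1#))))))
  quiddity-inner b B b′ (inj₂ (_ , _ , _ , m22≈-1)) = inj₁ (-‿injective
    (trans (sym (m22-M-∷-∷ʳ b B b′)) (trans m22≈-1 (*-identityʳ (- 1#)))))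

  -- Frames and solutions of the Hill equation

  Frame : Set c
  Frame = K² × K²

  Frame-setoid : Setoid c ℓ
  Frame-setoid = K²-setoid ×ₛ K²-setoid

  open Setoid Frame-setoid public
    using () renaming (_≈_ to _≈F_; reflexive to ≈F-reflexive; trans to ≈F-trans)

  step : Carrier → Frame → Frame
  step a (x , y) = a ⊙ x ⊖ y , x

  run : List Carrier → Frame → Frame
  run as s = foldl (flip step) s as

  initial : Frame
  initial = e₁ , e₀

  toMat : Frame → Mat
  toMat ((a , b) , (c , d)) = mat a b c d

  row₁ : Mat → K²
  row₁ (mat a b _ _) = a , b

  run-cong : ∀ as {s t} → s ≈F t → run as s ≈F run as t
  run-cong []       s≈t = s≈t
  run-cong (a ∷ as) ((x₁ , x₂) , (y₁ , y₂)) = run-cong as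
    ((+-cong (*-congˡ x₁) (-‿cong y₁) , +-cong (*-congˡ x₂) (-‿cong y₂)) , (x₁ , x₂))

  E·toMat : ∀ a s → (E a · toMat s) ≈M toMat (step a s)
  E·toMat a ((x₁ , x₂) , (y₁ , y₂)) =
    +-congˡ (-1*x≈-x y₁) , +-congˡ (-1*x≈-x y₂) , 1x+0y≈x x₁ y₁ , 1x+0y≈x x₂ y₂

  M-run : ∀ as s → (M as · toMat s) ≈M toMat (run as s)
  M-run []       s = ·-identityˡ (toMat s)
  M-run (a ∷ as) s = begin
    (M as · E a) · toMat s      ≈⟨ ·-assoc (M as) (E a) (toMat s) ⟩
    M as · (E a · toMat s)      ≈⟨ ·-cong ≈M-refl (E·toMat a s) ⟩
    M as · toMat (step a s)     ≈⟨ M-run as (step a s) ⟩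
    toMat (run as (step a s))   ∎
    where open ≈M-Reasoning

  det-row₁ : ∀ A s → det (row₁ (A · toMat s)) (proj₂ s) ≈ Mat.m11 A * det (proj₁ s) (proj₂ s)
  det-row₁ (mat a b _ _) ((x₁ , x₂) , (y₁ , y₂)) =
    solve 6 (λ a b x₁ x₂ y₁ y₂ → (a :* x₁ :+ b :* y₁) :* y₂ :- (a :* x₂ :+ b :* y₂) :* y₁
                                 := a :* (x₁ :* y₂ :- x₂ :* y₁)) refl a b x₁ x₂ y₁ y₂

  m11-run : ∀ as s → det (proj₁ s) (proj₂ s) ≈ 1# → Mat.m11 (M as) ≈ det (proj₁ (run as s)) (proj₂ s)
  m11-run as s det≈1 = begin
    Mat.m11 (M as)                             ≈⟨ *-identityʳ _ ⟨
    Mat.m11 (M as) * 1#                        ≈⟨ *-congˡ det≈1 ⟨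
    Mat.m11 (M as) * det (proj₁ s) (proj₂ s)   ≈⟨ det-row₁ (M as) s ⟨
    det (row₁ (M as · toMat s)) (proj₂ s)      ≈⟨ det-cong (m11≈ , m12≈) ≈²-refl ⟩
    det (proj₁ (run as s)) (proj₂ s)           ∎
    where
    open SetoidReasoning setoid
    m11≈ = proj₁ (M-run as s)
    m12≈ = proj₁ (proj₂ (M-run as s))

  run-initial⇒quiddity : ∀ as → run as initial ≈F initial → IsQuiddity as
  run-initial⇒quiddity as ((a , b) , (c , d)) = inj₁ (begin
    M as                     ≈⟨ ·-identityʳ (M as) ⟨
    M as · toMat initial     ≈⟨ M-run as initial ⟩
    toMat (run as initial)   ≈⟨ a , b , c , d ⟩
    Id                       ≈⟨ sym (*-identityˡ 1#) , sym (*-identityˡ 0#) , sym (*-identityˡ 0#) , sym (*-identityˡ 1#) ⟩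
    scal 1# Id               ∎)
    where open ≈M-Reasoning

  -- Entries past the end read as 0#; only indices below the length are ever used.
  nth : List Carrier → ℕ → Carrier
  nth []       _       = 0#
  nth (x ∷ xs) zero    = x
  nth (x ∷ xs) (suc i) = nth xs i

  nth-++ˡ : ∀ xs ys {j} → j < length xs → nth (xs ++ ys) j ≡ nth xs j
  nth-++ˡ (x ∷ xs) ys {zero}  _         = ≡.refl
  nth-++ˡ (x ∷ xs) ys {suc j} (s<s j<n) = nth-++ˡ xs ys j<n

  nth-++ʳ : ∀ xs ys j → nth (xs ++ ys) (j ℕ.+ length xs) ≡ nth ys j
  nth-++ʳ xs ys j = ≡.trans (≡.cong (nth (xs ++ ys)) (ℕ.+-comm j (length xs))) (skip xs)
    where
    skip : ∀ xs → nth (xs ++ ys) (length xs ℕ.+ j) ≡ nth ys j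
    skip []       = ≡.refl
    skip (x ∷ xs) = skip xs

  -- The solution of the discrete Hill equation V (i+2) = f i · V (i+1) − V i with V 0 = e₀, V 1 = e₁;
  -- for f = nth cs the frame (V (k+1), V k) consists of the rows of M (c₁, …, c_k).
  hill : (ℕ → Carrier) → ℕ → K²
  hill f zero          = e₀
  hill f (suc zero)    = e₁
  hill f (suc (suc i)) = f i ⊙ hill f (suc i) ⊖ hill f i

  frame : (ℕ → Carrier) → ℕ → Frame
  frame f k = hill f (suc k) , hill f k

  det-frame : ∀ f k → det (hill f (suc k)) (hill f k) ≈ 1#
  det-frame f zero    = trans (+-cong (*-identityʳ 1#) (-‿cong (zeroˡ 0#))) (trans (+-congˡ -0#≈0#) (+-identityʳ 1#))
  det-frame f (suc k) = trans (det-step (f k) (hill f (suc k)) (hill f k)) (det-frame f k)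

  hill-cong : ∀ {f g k} → (∀ {j} → j < k → f j ≡ g j) → ∀ {i} → i ≤ suc k → hill f i ≡ hill g i
  hill-cong f≗g {zero}        _         = ≡.refl
  hill-cong f≗g {suc zero}    _         = ≡.refl
  hill-cong f≗g {suc (suc i)} (s≤s i<k) =
    ≡.cong₂ _⊖_ (≡.cong₂ _⊙_ (f≗g i<k) (hill-cong f≗g (s≤s (ℕ.<⇒≤ i<k))))
                (hill-cong f≗g (ℕ.m<n⇒m≤1+n i<k))

  hill-++ : ∀ xs ys {i} → i ≤ suc (length xs) → hill (nth (xs ++ ys)) i ≡ hill (nth xs) i
  hill-++ xs ys = hill-cong (nth-++ˡ xs ys)

  hill-++-next : ∀ xs y ys → hill (nth (xs ++ y ∷ ys)) (2 ℕ.+ length xs) ≡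
                 y ⊙ hill (nth xs) (suc (length xs)) ⊖ hill (nth xs) (length xs)
  hill-++-next xs y ys = ≡.cong₂ _⊖_ (≡.cong₂ _⊙_ (nth-++ʳ xs (y ∷ ys) 0) (hill-++ xs (y ∷ ys) ℕ.≤-refl))
                                     (hill-++ xs (y ∷ ys) (ℕ.n≤1+n _))

  run-frame : ∀ f k P → (∀ {j} → j < length P → f (k ℕ.+ j) ≡ nth P j) →
              run P (frame f k) ≡ frame f (k ℕ.+ length P)
  run-frame f k []      _     = ≡.cong (frame f) (≡.sym (ℕ.+-identityʳ k))
  run-frame f k (a ∷ P) agree = begin
    run P (step a (frame f k))       ≡⟨ ≡.cong (λ b → run P (step b (frame f k))) f[k]≡a ⟨
    run P (frame f (suc k))          ≡⟨ run-frame f (suc k) P agree′ ⟩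
    frame f (suc k ℕ.+ length P)     ≡⟨ ≡.cong (frame f) (ℕ.+-suc k (length P)) ⟨
    frame f (k ℕ.+ suc (length P))   ∎
    where
    open ≡.≡-Reasoning
    f[k]≡a : f k ≡ a
    f[k]≡a = ≡.trans (≡.cong f (≡.sym (ℕ.+-identityʳ k))) (agree z<s)
    agree′ : ∀ {j} → j < length P → f (suc k ℕ.+ j) ≡ nth P j
    agree′ j<n = ≡.trans (≡.cong f (≡.sym (ℕ.+-suc k _))) (agree (s<s j<n))

  run-prefix : ∀ {w} P R → w ≡ P ++ R → run P initial ≡ frame (nth w) (length P)
  run-prefix P R ≡.refl = run-frame (nth (P ++ R)) 0 P (nth-++ˡ P R)

  m11-block : ∀ {w} P B S → w ≡ P ++ B ++ S →
              Mat.m11 (M B) ≈ det (hill (nth w) (suc (length (P ++ B)))) (hill (nth w) (length P))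
  m11-block {w} P B S w≡PBS = begin
    Mat.m11 (M B)                     ≈⟨ m11-run B σ det[σ]≈1 ⟩
    det (proj₁ (run B σ)) (proj₂ σ)   ≡⟨ ≡.cong₂ (λ s t → det (proj₁ s) (proj₂ t)) run-PB run-P ⟩
    det (hill (nth w) (suc (length (P ++ B)))) (hill (nth w) (length P)) ∎
    where
    open SetoidReasoning setoid
    σ = run P initial
    run-P : σ ≡ frame (nth w) (length P)
    run-P = run-prefix P (B ++ S) w≡PBS
    run-PB : run B σ ≡ frame (nth w) (length (P ++ B))
    run-PB = ≡.trans (≡.sym (List.foldl-++ (flip step) initial P B))
                     (run-prefix (P ++ B) S (≡.trans w≡PBS (≡.sym (List.++-assoc P B S))))
    det[σ]≈1 : det (proj₁ σ) (proj₂ σ) ≈ 1#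
    det[σ]≈1 = ≡.subst (λ s → det (proj₁ s) (proj₂ s) ≈ 1#) (≡.sym run-P) (det-frame (nth w) (length P))

  -- An irreducibility criterion

  _≉±1 : Carrier → Set ℓ
  x ≉±1 = (x ≉ 1#) × (x ≉ - 1#)

  ≉±1-resp-≈ : ∀ {x y} → x ≈ y → x ≉±1 → y ≉±1
  ≉±1-resp-≈ x≈y (x≉1 , x≉-1) = (λ y≈1 → x≉1 (trans x≈y y≈1)) , (λ y≈-1 → x≉-1 (trans x≈y y≈-1))

  -‿≉±1 : ∀ {x} → x ≉±1 → (- x) ≉±1
  -‿≉±1 (x≉1 , x≉-1) =
    (λ -x≈1 → x≉-1 (-‿injective (trans -x≈1 (sym (-‿involutive 1#))))) , (λ -x≈-1 → x≉1 (-‿injective -x≈-1))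

  det-swap-≉±1 : ∀ {x y} → det x y ≉±1 → det y x ≉±1
  det-swap-≉±1 {x} {y} = ≉±1-resp-≈ (sym (det-antisym y x)) ∘ -‿≉±1

  -- The blocks of cyclically consecutive entries of cs are the infixes of cs ++ cs shorter than cs.
  BlocksAvoid±1 : List Carrier → Set (c ⊔ ℓ)
  BlocksAvoid±1 cs = ∀ P B S → cs ++ cs ≡ P ++ B ++ S → 1 ≤ length B → 3 ℕ.+ length B ≤ length cs →
                     Mat.m11 (M B) ≉±1

  blocks-reverse : ∀ {cs} → BlocksAvoid±1 cs → BlocksAvoid±1 (reverse cs)
  blocks-reverse {cs} blocks P B S eq 1≤B 3+B≤n = ≉±1-resp-≈ (m11-reverse B)
    (blocks (reverse S) (reverse B) (reverse P) eq′
      (≡.subst (1 ≤_) (≡.sym (List.length-reverse B)) 1≤B)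
      (≡.subst₂ (λ b n → 3 ℕ.+ b ≤ n) (≡.sym (List.length-reverse B)) (List.length-reverse cs) 3+B≤n))
    where
    open ≡.≡-Reasoning
    eq′ : cs ++ cs ≡ reverse S ++ reverse B ++ reverse P
    eq′ = begin
      cs ++ cs                                ≡⟨ List.reverse-involutive (cs ++ cs) ⟨
      reverse (reverse (cs ++ cs))            ≡⟨ ≡.cong reverse (List.reverse-++ cs cs) ⟩
      reverse (reverse cs ++ reverse cs)      ≡⟨ ≡.cong reverse eq ⟩
      reverse (P ++ B ++ S)                   ≡⟨ List.reverse-++ P (B ++ S) ⟩
      reverse (B ++ S) ++ reverse P           ≡⟨ ≡.cong (_++ reverse P) (List.reverse-++ B S) ⟩
      (reverse S ++ reverse B) ++ reverse P   ≡⟨ List.++-assoc (reverse S) (reverse B) (reverse P) ⟩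
      reverse S ++ reverse B ++ reverse P     ∎

  blocks-rotate : ∀ {Z} → BlocksAvoid±1 Z → ∀ k {X Y} → drop k Z ++ take k Z ≡ X ++ Y →
                  3 ≤ length X → 1 ≤ length Y → Mat.m11 (M Y) ≉±1
  blocks-rotate {Z} blocks k {X} {Y} eq 3≤X 1≤Y =
    blocks (take k Z ++ X) Y (drop k Z) (rotate-infix k Z eq) 1≤Y
      (≡.subst (3 ℕ.+ length Y ≤_) |X|+|Y|≡|Z| (ℕ.+-monoˡ-≤ (length Y) 3≤X))
    where
    |X|+|Y|≡|Z| : length X ℕ.+ length Y ≡ length Z
    |X|+|Y|≡|Z| = ≡.trans (≡.sym (List.length-++ X)) (≡.trans (≡.cong length (≡.sym eq)) (length-rotate k Z))

  initOf-lastOf : ∀ x xs → x ∷ xs ≡ initOf x xs ∷ʳ lastOf x xs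
  initOf-lastOf x []       = ≡.refl
  initOf-lastOf x (y ∷ ys) = ≡.cong (x ∷_) (initOf-lastOf y ys)

  length-initOf : ∀ x xs → length (initOf x xs) ≡ length xs
  length-initOf x []       = ≡.refl
  length-initOf x (y ∷ ys) = ≡.cong suc (length-initOf y ys)

  blocks⇒¬reducible : ∀ {cs} → BlocksAvoid±1 cs → ¬ Reducible cs
  blocks⇒¬reducible _ ([]        , _      , _ , ()     , _)
  blocks⇒¬reducible _ (_ ∷ []    , _      , _ , s≤s () , _)
  blocks⇒¬reducible _ (_ ∷ _ ∷ _ , []     , _ , _ , ()     , _)
  blocks⇒¬reducible _ (_ ∷ _ ∷ _ , _ ∷ [] , _ , _ , s≤s () , _)
  blocks⇒¬reducible {cs} blocks
    (a₁ ∷ a₂ ∷ as , b₁ ∷ b₂ ∷ bs , quiddity , 3≤a , s≤s (s≤s 1≤bs) , k , _ , rotated) =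
    [ proj₁ inner≉±1 , proj₂ inner≉±1 ]′
      (quiddity-inner b₁ inner (lastOf b₂ bs) (≡.subst IsQuiddity (≡.cong (b₁ ∷_) (initOf-lastOf b₂ bs)) quiddity))
    where
    inner = initOf b₂ bs
    U = (a₁ + lastOf b₂ bs) ∷ initOf a₂ as ∷ʳ (lastOf a₂ as + b₁)

    ⊕≡U++inner : (a₁ ∷ a₂ ∷ as) ⊕ (b₁ ∷ b₂ ∷ bs) ≡ U ++ inner
    ⊕≡U++inner = ≡.cong ((a₁ + lastOf b₂ bs) ∷_) (≡.sym (List.++-assoc (initOf a₂ as) _ inner))

    |U|≡|a| : length U ≡ length (a₁ ∷ a₂ ∷ as)
    |U|≡|a| = ≡.cong suc (≡.trans (length-∷ʳ (initOf a₂ as) _) (≡.cong suc (length-initOf a₂ as)))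

    avoids : ∀ {Z} → BlocksAvoid±1 Z → Pointwise _≈_ ((a₁ ∷ a₂ ∷ as) ⊕ (b₁ ∷ b₂ ∷ bs)) (drop k Z ++ take k Z) →
             Mat.m11 (M inner) ≉±1
    avoids {Z} blocksZ rot
      with X , Y , eq , U≋X , inner≋Y ←
           Pointwise-++-split U (≡.subst (λ l → Pointwise _≈_ l (drop k Z ++ take k Z)) ⊕≡U++inner rot) =
      ≉±1-resp-≈ (sym (proj₁ (M-cong inner≋Y)))
        (blocks-rotate {Z} blocksZ k {X} {Y} eq
          (≡.subst (3 ≤_) (≡.trans (≡.sym |U|≡|a|) (Pointwise-length U≋X)) 3≤a)
          (≡.subst (1 ≤_) (≡.trans (≡.sym (length-initOf b₂ bs)) (Pointwise-length inner≋Y)) 1≤bs))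

    inner≉±1 : Mat.m11 (M inner) ≉±1
    inner≉±1 = [ avoids {cs} blocks , avoids {reverse cs} (blocks-reverse {cs} blocks) ]′ rotated

  NonAdjacent≉±1 : List Carrier → Set ℓ
  NonAdjacent≉±1 cs = ∀ {i j} → 2 ℕ.+ i ≤ j → 2 ℕ.+ j ≤ i ℕ.+ length cs → j < length cs →
                      det (hill (nth cs) i) (hill (nth cs) j) ≉±1

  module _ {cs} (closes : run cs initial ≈F initial) where
    private
      n = length cs
      f = nth (cs ++ cs)

    frame-periodic : ∀ {i} → i ≤ n → frame f (i ℕ.+ n) ≈F frame f i
    frame-periodic {i} i≤n = begin
      frame f (i ℕ.+ n)                    ≡⟨ ≡.cong (frame f) |cs++take| ⟨
      frame f (length (cs ++ take i cs))   ≡⟨ run-prefix (cs ++ take i cs) (drop i cs) eq₁ ⟨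
      run (cs ++ take i cs) initial        ≡⟨ List.foldl-++ (flip step) initial cs (take i cs) ⟩
      run (take i cs) (run cs initial)     ≈⟨ run-cong (take i cs) closes ⟩
      run (take i cs) initial              ≡⟨ run-prefix (take i cs) (drop i cs ++ cs) eq₂ ⟩
      frame f (length (take i cs))         ≡⟨ ≡.cong (frame f) |take| ⟩
      frame f i                            ∎
      where
      open SetoidReasoning Frame-setoid
      |take| : length (take i cs) ≡ i
      |take| = ≡.trans (List.length-take i cs) (ℕ.m≤n⇒m⊓n≡m i≤n)
      |cs++take| : length (cs ++ take i cs) ≡ i ℕ.+ n
      |cs++take| = ≡.trans (List.length-++ cs) (≡.trans (≡.cong (n ℕ.+_) |take|) (ℕ.+-comm n i))
      eq₁ : cs ++ cs ≡ (cs ++ take i cs) ++ drop i cs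
      eq₁ = ≡.trans (≡.cong (cs ++_) (≡.sym (List.take++drop≡id i cs))) (≡.sym (List.++-assoc cs _ _))
      eq₂ : cs ++ cs ≡ take i cs ++ drop i cs ++ cs
      eq₂ = ≡.trans (≡.cong (_++ cs) (≡.sym (List.take++drop≡id i cs))) (List.++-assoc (take i cs) (drop i cs) cs)

    hill-periodic : ∀ {i} → i ≤ suc n → hill f (i ℕ.+ n) ≈² hill f i
    hill-periodic {zero}  _         = proj₂ (frame-periodic z≤n)
    hill-periodic {suc i} (s≤s i≤n) = proj₁ (frame-periodic i≤n)

    module _ (nonadjacent : NonAdjacent≉±1 cs) where
      private
        first-copy : ∀ {i} → i ≤ suc n → hill f i ≈² hill (nth cs) i
        first-copy = ≈²-reflexive ∘ hill-++ cs cs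

        nonadjacent-from-first-copy : ∀ {i j} → i < n → 2 ℕ.+ i ≤ j → 2 ℕ.+ j ≤ i ℕ.+ n → j ≤ suc (n ℕ.+ n) →
                                      det (hill f i) (hill f j) ≉±1
        nonadjacent-from-first-copy {i} {j} i<n 2+i≤j 2+j≤i+n j≤ with j ℕ.<? n
        ... | yes j<n = ≉±1-resp-≈ (sym (det-cong (first-copy (ℕ.m<n⇒m≤1+n i<n)) (first-copy (ℕ.m<n⇒m≤1+n j<n))))
                          (nonadjacent 2+i≤j 2+j≤i+n j<n)
        ... | no j≮n with j′ , ≡.refl ← m≤n⇒∃[o]n≡o+m (ℕ.≮⇒≥ j≮n) =
          ≉±1-resp-≈ (sym (det-cong (first-copy (ℕ.m<n⇒m≤1+n i<n))
                                    (≈²-trans (hill-periodic j′≤) (first-copy j′≤))))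
            (det-swap-≉±1 (nonadjacent (ℕ.+-cancelʳ-≤ n (2 ℕ.+ j′) i 2+j≤i+n) 2+i≤j i<n))
          where
          j′≤ : j′ ≤ suc n
          j′≤ = ℕ.+-cancelʳ-≤ n j′ (suc n) j≤

      nonadjacent-doubled : ∀ {i j} → 2 ℕ.+ i ≤ j → 2 ℕ.+ j ≤ i ℕ.+ n → j ≤ suc (n ℕ.+ n) →
                            det (hill f i) (hill f j) ≉±1
      nonadjacent-doubled {i} {j} 2+i≤j 2+j≤i+n j≤ with i ℕ.<? n
      ... | yes i<n = nonadjacent-from-first-copy i<n 2+i≤j 2+j≤i+n j≤
      ... | no i≮n
        with i′ , ≡.refl ← m≤n⇒∃[o]n≡o+m (ℕ.≮⇒≥ i≮n)
        with j′ , ≡.refl ← m≤n⇒∃[o]n≡o+m (ℕ.≤-trans (ℕ.m≤n+m n (2 ℕ.+ i′)) 2+i≤j) =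
        ≉±1-resp-≈ (sym (det-cong (hill-periodic (ℕ.m<n⇒m≤1+n i′<n)) (hill-periodic j′≤)))
          (nonadjacent-from-first-copy i′<n 2+i′≤j′ (ℕ.+-cancelʳ-≤ n (2 ℕ.+ j′) (i′ ℕ.+ n) 2+j≤i+n)
            (ℕ.≤-trans j′≤ (s≤s (ℕ.m≤m+n n n))))
        where
        j′≤ : j′ ≤ suc n
        j′≤ = ℕ.+-cancelʳ-≤ n j′ (suc n) j≤
        2+i′≤j′ : 2 ℕ.+ i′ ≤ j′
        2+i′≤j′ = ℕ.+-cancelʳ-≤ n (2 ℕ.+ i′) j′ 2+i≤j
        i′<n : i′ < n
        i′<n = ℕ.≤-pred (ℕ.≤-trans 2+i′≤j′ j′≤)

      nonadjacent⇒blocks : BlocksAvoid±1 cs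
      nonadjacent⇒blocks P B S eq 1≤B 3+B≤n =
        ≉±1-resp-≈ (sym (m11-block P B S eq)) (det-swap-≉±1 (nonadjacent-doubled 2+p≤q 2+q≤p+n q≤))
        where
        p = length P
        q = suc (length (P ++ B))
        |P++B| : length (P ++ B) ≡ p ℕ.+ length B
        |P++B| = List.length-++ P
        2+p≤q : 2 ℕ.+ p ≤ q
        2+p≤q = s≤s (≡.subst (suc p ≤_) (≡.sym |P++B|) (ℕ.m<m+n p 1≤B))
        2+q≤p+n : 2 ℕ.+ q ≤ p ℕ.+ n
        2+q≤p+n = ≡.subst (_≤ p ℕ.+ n) p+[3+b]≡3+|P++B| (ℕ.+-monoʳ-≤ p 3+B≤n)
          where
          p+[3+b]≡3+|P++B| : p ℕ.+ (3 ℕ.+ length B) ≡ 3 ℕ.+ length (P ++ B)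
          p+[3+b]≡3+|P++B| = ≡.trans (≡.sym (ℕ.+-assoc p 3 (length B)))
                               (≡.trans (≡.cong (ℕ._+ length B) (ℕ.+-comm p 3)) (≡.cong (3 ℕ.+_) (≡.sym |P++B|)))
        q≤ : q ≤ suc (n ℕ.+ n)
        q≤ = s≤s (≡.subst (length (P ++ B) ≤_)
          (≡.trans (≡.cong length (≡.trans (List.++-assoc P B S) (≡.sym eq))) (List.length-++ cs))
          (List.length-++-≤ˡ (P ++ B)))

module Construction {c ℓ} (K : CommutativeRing c ℓ) (isField : IsField K) (infinite : Infinite K) where
  open CommutativeRing K
  open IsField isField
  open Quiddity K
  open Continuants K
  open CommutativeRingSolver K using (solve; _:=_; _:+_; _:*_; _:-_; :-_; con; ⟦_⟧ₛ)
  open import Algebra.Properties.Ring ring using (-‿injective; -1*x≈-x; -0#≈0#)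
  open import Data.List.Membership.Setoid setoid using (_∉_)
  open import Data.List.Membership.Setoid.Properties using (∈-++⁺ˡ; ∈-++⁺ʳ)
  open SetoidReasoning setoid

  Cofinite : ∀ {p} → (Carrier → Set p) → Set (c ⊔ ℓ ⊔ p)
  Cofinite P = Σ (List Carrier) λ exceptions → ∀ a → a ∉ exceptions → P a

  cofinite-witness : ∀ {p} {P : Carrier → Set p} → Cofinite P → Σ Carrier P
  cofinite-witness (xs , outside) = let a , a∉xs = infinite xs in a , outside a a∉xs

  cofinite-× : ∀ {p q} {P : Carrier → Set p} {Q : Carrier → Set q} →
               Cofinite P → Cofinite Q → Cofinite (λ a → P a × Q a)
  cofinite-× (xs , P-outside) (ys , Q-outside) =
    xs ++ ys , λ a a∉ → P-outside a (a∉ ∘ ∈-++⁺ˡ setoid) , Q-outside a (a∉ ∘ ∈-++⁺ʳ setoid xs)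

  cofinite-∀< : ∀ {p} {P : ℕ → Carrier → Set p} n → (∀ {i} → i < n → Cofinite (P i)) →
                Cofinite (λ a → ∀ {i} → i < n → P i a)
  cofinite-∀< zero    _    = [] , λ _ _ ()
  cofinite-∀< (suc n) each =
    let xs , outside = cofinite-× (each (ℕ.n<1+n n)) (cofinite-∀< n (each ∘ ℕ.m<n⇒m<1+n))
    in xs , λ a a∉ → ∀<suc (proj₁ (outside a a∉)) (proj₂ (outside a a∉))

  cofinite-∀± : ∀ {p} {P : Sign → Carrier → Set p} → (∀ s → Cofinite (P s)) → Cofinite (λ a → ∀ s → P s a)
  cofinite-∀± each =
    let xs , outside = cofinite-× (each Sign.+) (each Sign.-)
    in xs , λ { a a∉ Sign.+ → proj₁ (outside a a∉) ; a a∉ Sign.- → proj₂ (outside a a∉) }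

  -- det t (a ⊙ y ⊖ x) is affine in a with nonzero slope det t y, so each forbidden value is hit by one a only.
  cofinite-det : ∀ {t y} x τs → det t y ≉ 0# → Cofinite (λ a → det t (a ⊙ y ⊖ x) ∉ τs)
  cofinite-det {t} {y} x τs slope≉0 =
    map (λ τ → (τ + det t x) * slope⁻¹) τs , λ a a∉ hit → a∉ (Anyₚ.map⁺ (Any.map (solve-for a) hit))
    where
    slope = det t y
    slope⁻¹ = proj₁ (inverse slope slope≉0)
    solve-for : ∀ a {τ} → det t (a ⊙ y ⊖ x) ≈ τ → a ≈ (τ + det t x) * slope⁻¹
    solve-for a {τ} hit = begin
      a                                             ≈⟨ *-identityʳ a ⟨
      a * 1#                                        ≈⟨ *-congˡ (proj₂ (inverse slope slope≉0)) ⟨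
      a * (slope * slope⁻¹)                         ≈⟨ solve 4 (λ a d e i → a :* (d :* i) := ((a :* d :- e) :+ e) :* i)
                                                         refl a slope (det t x) slope⁻¹ ⟩
      ((a * slope - det t x) + det t x) * slope⁻¹   ≈⟨ *-congʳ (+-congʳ (trans (sym (det-linearʳ t a y x)) hit)) ⟩
      (τ + det t x) * slope⁻¹                       ∎

  -- Generic sequences

  -- far also excludes 0 so that, once g is extended, it provides the nonzero slopes cofinite-det needs;
  -- shifted at j = length g + 1 is what closing the polygon needs (det-closing), and excludes 0 for the same reason.
  record Generic (g : List Carrier) : Set (c ⊔ ℓ) where
    field
      far     : ∀ {i j} → 2 ℕ.+ i ≤ j → j ≤ suc (length g) →
                det (hill (nth g) i) (hill (nth g) j) ∉ (0# ∷ 1# ∷ - 1# ∷ [])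
      shifted : ∀ {i j} → 1 ≤ i → i < j → j ≤ suc (length g) → ∀ s →
                det (hill (nth g) i ⊖ ⟦ s ⟧ₛ ⊙ e₀) (hill (nth g) j) ∉ (0# ∷ det e₀ (hill (nth g) i) ∷ [])
  open Generic

  generic-[] : Generic []
  generic-[] = record
    { far     = λ 2+i≤j j≤1 → ⊥-elim (ℕ.n≮n 1 (ℕ.≤-trans (ℕ.m≤m+n 2 _) (ℕ.≤-trans 2+i≤j j≤1)))
    ; shifted = λ 1≤i i<j j≤1 _ → ⊥-elim (ℕ.n≮n 1 (ℕ.≤-trans (s≤s 1≤i) (ℕ.≤-trans i<j j≤1)))
    }

  -1≉0 : - 1# ≉ 0#
  -1≉0 -1≈0 = 1≉0 (-‿injective (trans -1≈0 (sym -0#≈0#)))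

  det-e₀ : ∀ v → det e₀ v ≈ - proj₁ v
  det-e₀ (v₁ , v₂) = solve 2 (λ v₁ v₂ → con (+ 0) :* v₂ :- con (+ 1) :* v₁ := :- v₁) refl v₁ v₂

  det-shifted-self : ∀ s v → det (v ⊖ ⟦ s ⟧ₛ ⊙ e₀) v ≈ ⟦ s ⟧ₛ * proj₁ v
  det-shifted-self s (v₁ , v₂) =
    solve 3 (λ σ v₁ v₂ → (v₁ :- σ :* con (+ 0)) :* v₂ :- (v₂ :- σ :* con (+ 1)) :* v₁ := σ :* v₁)
      refl ⟦ s ⟧ₛ v₁ v₂

  ±1*≉0 : ∀ s {x} → x ≉ 0# → ⟦ s ⟧ₛ * x ≉ 0#
  ±1*≉0 Sign.+ {x} x≉0 1x≈0  = x≉0 (trans (sym (*-identityˡ x)) 1x≈0)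
  ±1*≉0 Sign.- {x} x≉0 -1x≈0 = x≉0 (-‿injective (trans (sym (-1*x≈-x x)) (trans -1x≈0 (sym -0#≈0#))))

  top₁≉0 : ∀ {g} → Generic g → proj₁ (hill (nth g) (suc (length g))) ≉ 0#
  top₁≉0 {[]}    _ = 1≉0
  top₁≉0 {x ∷ g} G p≈0 =
    far G {0} (s≤s (s≤s z≤n)) ℕ.≤-refl (here (trans (det-e₀ _) (trans (-‿cong p≈0) -0#≈0#)))

  module _ {g} (G : Generic g) where
    private
      m = suc (length g)
      u = hill (nth g)

      next : Carrier → K²
      next a = a ⊙ u m ⊖ u (length g)

    Admissible : Carrier → Set (c ⊔ ℓ)
    Admissible a =
      (∀ {i} → i < m → det (u i) (next a) ∉ (0# ∷ 1# ∷ - 1# ∷ [])) ×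
      (∀ {i} → i < m → ∀ s → det (u (suc i) ⊖ ⟦ s ⟧ₛ ⊙ e₀) (next a) ∉ (0# ∷ det e₀ (u (suc i)) ∷ []))

    private
      slope-far : ∀ {i} → i < m → det (u i) (u m) ≉ 0#
      slope-far {i} (s≤s i≤|g|) with ℕ.m≤n⇒m<n∨m≡n i≤|g|
      ... | inj₁ i<|g|  = far G (s≤s i<|g|) ℕ.≤-refl ∘ here
      ... | inj₂ ≡.refl = λ det≈0 → -1≉0 (begin
        - 1#                         ≈⟨ -‿cong (det-frame (nth g) (length g)) ⟨
        - det (u m) (u (length g))   ≈⟨ det-antisym (u (length g)) (u m) ⟨
        det (u (length g)) (u m)     ≈⟨ det≈0 ⟩
        0#                           ∎)

      slope-shifted : ∀ {i} → i < m → ∀ s → det (u (suc i) ⊖ ⟦ s ⟧ₛ ⊙ e₀) (u m) ≉ 0#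
      slope-shifted {i} i<m s with ℕ.m≤n⇒m<n∨m≡n i<m
      ... | inj₁ 1+i<m  = shifted G (s≤s z≤n) 1+i<m ℕ.≤-refl s ∘ here
      ... | inj₂ ≡.refl = ±1*≉0 s (top₁≉0 G) ∘ trans (sym (det-shifted-self s (u m)))

    admissible-cofinite : Cofinite Admissible
    admissible-cofinite =
      cofinite-× (cofinite-∀< m λ i<m → cofinite-det (u (length g)) _ (slope-far i<m))
                 (cofinite-∀< m λ i<m → cofinite-∀± λ s → cofinite-det (u (length g)) _ (slope-shifted i<m s))

    extend-with : ∀ {a} → Admissible a → Generic (g ∷ʳ a)
    extend-with {a} (far-next , shifted-next) = record { far = far′ ; shifted = shifted′ }
      where
      u′ = hill (nth (g ∷ʳ a))

      old : ∀ {i} → i ≤ m → u′ i ≡ u i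
      old = hill-++ g [ a ]

      new : u′ (suc m) ≡ next a
      new = hill-++-next g a []

      j≤1+m : ∀ {j} → j ≤ suc (length (g ∷ʳ a)) → j < suc m ⊎ j ≡ suc m
      j≤1+m {j} = ℕ.m≤n⇒m<n∨m≡n ∘ ≡.subst (λ n → j ≤ suc n) (length-∷ʳ g a)

      far′ : ∀ {i j} → 2 ℕ.+ i ≤ j → j ≤ suc (length (g ∷ʳ a)) → det (u′ i) (u′ j) ∉ (0# ∷ 1# ∷ - 1# ∷ [])
      far′ {i} {j} 2+i≤j j≤ with j≤1+m j≤
      ... | inj₁ (s≤s j≤m) =
        ≡.subst₂ (λ v w → det v w ∉ _) (≡.sym (old (ℕ.m+n≤o⇒n≤o 2 (ℕ.≤-trans 2+i≤j j≤m))))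
                                       (≡.sym (old j≤m))
          (far G 2+i≤j j≤m)
      ... | inj₂ ≡.refl =
        ≡.subst₂ (λ v w → det v w ∉ _) (≡.sym (old (ℕ.<⇒≤ (ℕ.≤-pred 2+i≤j)))) (≡.sym new)
          (far-next (ℕ.≤-pred 2+i≤j))

      shifted′ : ∀ {i j} → 1 ≤ i → i < j → j ≤ suc (length (g ∷ʳ a)) → ∀ s →
                 det (u′ i ⊖ ⟦ s ⟧ₛ ⊙ e₀) (u′ j) ∉ (0# ∷ det e₀ (u′ i) ∷ [])
      shifted′ {suc i} {j} 1≤i i<j j≤ s with j≤1+m j≤
      ... | inj₁ (s≤s j≤m) =
        ≡.subst₂ (λ v w → det (v ⊖ ⟦ s ⟧ₛ ⊙ e₀) w ∉ (0# ∷ det e₀ v ∷ []))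
          (≡.sym (old (ℕ.<⇒≤ (ℕ.<-≤-trans i<j j≤m)))) (≡.sym (old j≤m))
          (shifted G 1≤i i<j j≤m s)
      ... | inj₂ ≡.refl =
        ≡.subst₂ (λ v w → det (v ⊖ ⟦ s ⟧ₛ ⊙ e₀) w ∉ (0# ∷ det e₀ v ∷ []))
          (≡.sym (old (ℕ.≤-pred i<j))) (≡.sym new)
          (shifted-next (ℕ.≤-pred i<j) s)

    extend : Σ Carrier λ a → Generic (g ∷ʳ a)
    extend = let a , admissible = cofinite-witness admissible-cofinite in a , extend-with admissible

  generic : ∀ k → Σ (List Carrier) λ g → length g ≡ k × Generic g
  generic zero    = [] , ≡.refl , generic-[]
  generic (suc k) with g , ≡.refl , G ← generic k =
    let a , G′ = extend G in g ∷ʳ a , length-∷ʳ g a , G′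

  -- Closing the polygon

  det-closing : ∀ {v y w t} → proj₁ w ≈ - 1# → det y w ≈ - 1# → det v w ≈ t →
                det (v ⊖ t ⊙ e₀) y ≈ det e₀ v
  det-closing {v₁ , v₂} {y₁ , y₂} {w₁ , w₂} {t} w₁≈-1 det[y,w]≈-1 det[v,w]≈t = begin
    det (v ⊖ t ⊙ e₀) y
      ≈⟨ solve 7 (λ v₁ v₂ y₁ y₂ w₁ w₂ t →
           (v₁ :- t :* con (+ 0)) :* y₂ :- (v₂ :- t :* con (+ 1)) :* y₁
             := (con (+ 0) :* v₂ :- con (+ 1) :* v₁)
                :+ (v₁ :* ((y₁ :* w₂ :- y₂ :* w₁) :+ con (+ 1))
                    :+ y₁ :* (t :- (v₁ :* w₂ :- v₂ :* w₁))
                    :+ (v₁ :* y₂ :- v₂ :* y₁) :* (w₁ :+ con (+ 1)))) refl v₁ v₂ y₁ y₂ w₁ w₂ t ⟩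
    det e₀ v + (v₁ * (det y w + 1#) + y₁ * (t - det v w) + det v y * (w₁ + 1#))
      ≈⟨ +-congˡ (+-cong (+-cong (*-congˡ (+-congʳ det[y,w]≈-1)) (*-congˡ (+-congˡ (-‿cong det[v,w]≈t))))
                         (*-congˡ (+-congʳ w₁≈-1))) ⟩
    det e₀ v + (v₁ * (- 1# + 1#) + y₁ * (t - t) + det v y * (- 1# + 1#))
      ≈⟨ solve 5 (λ v₁ v₂ y₁ t d → (con (+ 0) :* v₂ :- con (+ 1) :* v₁)
           :+ (v₁ :* (:- con (+ 1) :+ con (+ 1)) :+ y₁ :* (t :- t) :+ d :* (:- con (+ 1) :+ con (+ 1)))
             := con (+ 0) :* v₂ :- con (+ 1) :* v₁) refl v₁ v₂ y₁ t (det v y) ⟩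
    det e₀ v ∎
    where v = v₁ , v₂; y = y₁ , y₂; w = w₁ , w₂

  ∉0±1⇒≉±1 : ∀ {x} → x ∉ (0# ∷ 1# ∷ - 1# ∷ []) → x ≉±1
  ∉0±1⇒≉±1 x∉ = (λ x≈1 → x∉ (there (here x≈1))) , (λ x≈-1 → x∉ (there (there (here x≈-1))))

  module Closing {g} (G : Generic g) where
    private
      m = suc (length g)
      u = hill (nth g)
      p = proj₁ (u m)
      q = proj₂ (u m)
      r = proj₁ (u (length g))
      s = proj₂ (u (length g))
      p⁻¹ = proj₁ (inverse p (top₁≉0 G))

    -- Forced by V (m+2) = e₀ = V 0 and V (m+3) = e₁ = V 1: x makes −1 the first coordinate of
    -- V (m+1) = x ⊙ V m ⊖ V (m−1), and z is its second coordinate.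
    x y z : Carrier
    x = (r - 1#) * p⁻¹
    y = - p
    z = x * q - s

    closed : List Carrier
    closed = g ++ x ∷ y ∷ z ∷ []

    private
      uc = hill (nth closed)
      w = x ⊙ u m ⊖ u (length g)

      uc-old : ∀ {i} → i ≤ m → uc i ≡ u i
      uc-old = hill-++ g (x ∷ y ∷ z ∷ [])

      uc-next : uc (suc m) ≡ w
      uc-next = hill-++-next g x (y ∷ z ∷ [])

      |closed| : length closed ≡ 2 ℕ.+ m
      |closed| = ≡.trans (List.length-++ g) (ℕ.+-comm (length g) 3)

      x*p≈r-1 : x * p ≈ r - 1#
      x*p≈r-1 = begin
        (r - 1#) * p⁻¹ * p     ≈⟨ solve 3 (λ a i p → a :* i :* p := a :* (p :* i)) refl (r - 1#) p⁻¹ p ⟩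
        (r - 1#) * (p * p⁻¹)   ≈⟨ *-congˡ (proj₂ (inverse p (top₁≉0 G))) ⟩
        (r - 1#) * 1#          ≈⟨ *-identityʳ _ ⟩
        r - 1#                 ∎

      w₁≈-1 : proj₁ w ≈ - 1#
      w₁≈-1 = begin
        x * p - r              ≈⟨ +-congʳ x*p≈r-1 ⟩
        (r - 1#) - r           ≈⟨ solve 1 (λ r → (r :- con (+ 1)) :- r := :- con (+ 1)) refl r ⟩
        - 1#                   ∎

      det[u,w]≈-1 : det (u m) w ≈ - 1#
      det[u,w]≈-1 = begin
        det (u m) w                  ≈⟨ det-antisym (u m) w ⟩
        - det w (u m)                ≈⟨ -‿cong (det-step x (u m) (u (length g))) ⟩
        - det (u m) (u (length g))   ≈⟨ -‿cong (det-frame (nth g) (length g)) ⟩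
        - 1#                         ∎

      uc-e₀ : uc (2 ℕ.+ m) ≈² e₀
      uc-e₀ = ≈²-trans (≈²-reflexive (≡.cong₂ _⊖_ (≡.cong₂ _⊙_ (nth-++ʳ g (x ∷ y ∷ z ∷ []) 1) uc-next)
                                                 (uc-old ℕ.≤-refl)))
                       (first , second)
        where
        first : - p * proj₁ w - p ≈ 0#
        first = begin
          - p * proj₁ w - p    ≈⟨ +-congʳ (*-congˡ w₁≈-1) ⟩
          - p * - 1# - p       ≈⟨ solve 1 (λ p → :- p :* :- con (+ 1) :- p := con (+ 0)) refl p ⟩
          0#                   ∎
        second : - p * (x * q - s) - q ≈ 1#
        second = begin
          - p * (x * q - s) - q
            ≈⟨ solve 5 (λ p q r s x → :- p :* (x :* q :- s) :- q
                                      := (p :* s :- q :* r) :- q :* (x :* p :- (r :- con (+ 1)))) refl p q r s x ⟩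
          det (u m) (u (length g)) - q * (x * p - (r - 1#))
            ≈⟨ +-cong (det-frame (nth g) (length g)) (-‿cong (*-congˡ (+-congʳ x*p≈r-1))) ⟩
          1# - q * ((r - 1#) - (r - 1#))
            ≈⟨ solve 2 (λ q a → con (+ 1) :- q :* (a :- a) := con (+ 1)) refl q (r - 1#) ⟩
          1# ∎

      uc-e₁ : uc (3 ℕ.+ m) ≈² e₁
      uc-e₁ = ≈²-trans (≈²-reflexive (≡.cong₂ _⊖_ (≡.cong (_⊙ uc (2 ℕ.+ m)) (nth-++ʳ g (x ∷ y ∷ z ∷ []) 2))
                                                 uc-next))
                       (first , second)
        where
        first : z * proj₁ (uc (2 ℕ.+ m)) - proj₁ w ≈ 1#
        first = begin
          z * proj₁ (uc (2 ℕ.+ m)) - proj₁ w   ≈⟨ +-cong (*-congˡ (proj₁ uc-e₀)) (-‿cong w₁≈-1) ⟩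
          z * 0# - - 1#                        ≈⟨ solve 1 (λ z → z :* con (+ 0) :- :- con (+ 1) := con (+ 1)) refl z ⟩
          1#                                   ∎
        second : z * proj₂ (uc (2 ℕ.+ m)) - z ≈ 0#
        second = begin
          z * proj₂ (uc (2 ℕ.+ m)) - z         ≈⟨ +-congʳ (*-congˡ (proj₂ uc-e₀)) ⟩
          z * 1# - z                           ≈⟨ solve 1 (λ z → z :* con (+ 1) :- z := con (+ 0)) refl z ⟩
          0#                                   ∎

    closes : run closed initial ≈F initial
    closes = ≈F-trans (≈F-reflexive (≡.trans (run-prefix closed [] (≡.sym (List.++-identityʳ closed)))
                                             (≡.cong (frame (nth closed)) |closed|)))
                      (uc-e₁ , uc-e₀)

    nonadjacent : NonAdjacent≉±1 closed
    nonadjacent {i} {j} 2+i≤j 2+j≤i+n j<n with ℕ.m≤n⇒m<n∨m≡n (ℕ.≤-pred (≡.subst (j <_) |closed| j<n))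
    ... | inj₁ (s≤s j≤m) =
      ≉±1-resp-≈ (reflexive (≡.sym (≡.cong₂ det (uc-old (ℕ.m+n≤o⇒n≤o 2 (ℕ.≤-trans 2+i≤j j≤m)))
                                                 (uc-old j≤m))))
        (∉0±1⇒≉±1 (far G 2+i≤j j≤m))
    ... | inj₂ ≡.refl =
      ≉±1-resp-≈ (reflexive (≡.sym (≡.cong₂ det (uc-old (ℕ.<⇒≤ i<m)) uc-next)))
        (avoids Sign.+ , avoids Sign.-)
      where
      i<m : i < m
      i<m = ℕ.≤-pred 2+i≤j
      1≤i : 1 ≤ i
      1≤i = ℕ.+-cancelʳ-≤ (2 ℕ.+ m) 1 i (≡.subst (λ n → 2 ℕ.+ j ≤ i ℕ.+ n) |closed| 2+j≤i+n)
      avoids : ∀ s → det (u i) w ≉ ⟦ s ⟧ₛ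
      avoids s hit = shifted G 1≤i i<m ℕ.≤-refl s (there (here (det-closing w₁≈-1 det[u,w]≈-1 hit)))

    irreducible : Irreducible closed
    irreducible = run-initial⇒quiddity closed closes ,
                  ≡.subst (3 ≤_) (≡.sym |closed|) (s≤s (s≤s (s≤s z≤n))) ,
                  blocks⇒¬reducible (nonadjacent⇒blocks {closed} closes nonadjacent)

  irreducible-of-size : ∀ k → Σ (List Carrier) λ cs → length cs ≡ k ℕ.+ 3 × Irreducible cs
  irreducible-of-size k with g , ≡.refl , G ← generic k = closed , List.length-++ g , irreducible
    where open Closing G

open import Data.Nat using (_+_; _*_)

theorem3p12 : ∀ {c ℓ} (K : CommutativeRing c ℓ) → IsField K → Infinite K →
    ((k : ℕ) → Σ (List (CommutativeRing.Carrier K)) (λ as →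
        (length as ≡ 2 * k + 3) × Quiddity.Irreducible K as))
    × ((N : ℕ) → Σ (List (CommutativeRing.Carrier K)) (λ as →
        (N ≤ length as) × Quiddity.Irreducible K as))
theorem3p12 K isField infinite =
  (λ k → irreducible-of-size (2 * k)) ,
  (λ N → let cs , |cs|≡N+3 , irreducible = irreducible-of-size N
         in cs , ≡.subst (N ≤_) (≡.sym |cs|≡N+3) (ℕ.m≤m+n N 3) , irreducible)
  where open Construction K isField infinite
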